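{- Let $G_1$ and $G_2$ be vertex-disjoint finite connected graphs with distance matrices $D_1,D_2$ such that neither linear system $D_1x=\mathbf{1}$ nor $D_2x=\mathbf{1}$ has a solution. Let $u\in V(G_1)$, $v\in V(G_2)$, and let $H$ be obtained by adding the edge $\{u,v\}$ between $G_1$ and $G_2$ and then contracting this edge (i.e. identifying $u$ and $v$). If $D_H$ is the distance matrix of $H$, then the linear system $D_Hx=\mathbf{1}$ has no solution.
   Context: For a finite connected graph with vertices $v_1,\dots,v_m$, the distance matrix is $D_{ij}=d(v_i,v_j)$ (shortest-path distance), and $\mathbf{1}$ denotes the all-ones vector of the appropriate size.
   Formalization: Solutions of the systems $D_1x=\mathbf{1}$, $D_2x=\mathbf{1}$ and $D_Hx=\mathbf{1}$ are taken over ℚ. -}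

module Defs where

open import Data.Nat using (ℕ; zero; suc; _+_; _≤_)
open import Data.Fin using (Fin; splitAt; punchIn; _≟_)
open import Data.Bool using (Bool; true; false; if_then_else_)
open import Data.Sum using (_⊎_; inj₁; inj₂)
open import Data.Product using (Σ; ∃; _×_)
open import Data.Integer using (+_)
open import Data.Rational using (ℚ; _/_; 1ℚ; 0ℚ) renaming (_+_ to _+ℚ_; _*_ to _*ℚ_)
open import Data.Vec.Functional using (foldr)
open import Relation.Nullary using (does)
open import Relation.Binary.PropositionalEquality using (_≡_)

Graph : ℕ → Set
Graph n = Fin n → Fin n → Bool

IsSimple : ∀ {n} → Graph n → Set
IsSimple {n} G = (∀ (i j : Fin n) → G i j ≡ G j i) × (∀ (i : Fin n) → G i i ≡ false)

data Walk {n : ℕ} (G : Graph n) : Fin n → Fin n → ℕ → Set where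
  nil  : ∀ {i} → Walk G i i 0
  cons : ∀ {i l j k} → G i l ≡ true → Walk G l j k → Walk G i j (suc k)

Connected : ∀ {n} → Graph n → Set
Connected {n} G = ∀ (i j : Fin n) → ∃ λ k → Walk G i j k

IsDistance : ∀ {n} → Graph n → Fin n → Fin n → ℕ → Set
IsDistance G i j d = Walk G i j d × (∀ k → Walk G i j k → d ≤ k)

IsDistanceMatrix : ∀ {n} → Graph n → (Fin n → Fin n → ℕ) → Set
IsDistanceMatrix {n} G D = ∀ (i j : Fin n) → IsDistance G i j (D i j)

ℕtoℚ : ℕ → ℚ
ℕtoℚ k = (+ k) / 1

HasSolutionOnes : ∀ {n} → (Fin n → Fin n → ℕ) → Set
HasSolutionOnes {n} D =
  Σ (Fin n → ℚ) λ x → ∀ (i : Fin n) → foldr _+ℚ_ 0ℚ (λ j → ℕtoℚ (D i j) *ℚ x j) ≡ 1ℚ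

-- The vertex set of H is Fin (m + n'):
-- the first m vertices are those of G1 (u playing the role of u = v),
-- the last n' vertices are those of G2 other than v, in order
-- (vertex b of G2 - {v} corresponds to punchIn v b in G2).
coalesce : ∀ {m n'} → Graph m → Graph (suc n') → Fin m → Fin (suc n') → Graph (m + n')
coalesce {m} {n'} G1 G2 u v x y with splitAt m x | splitAt m y
... | inj₁ a | inj₁ b = G1 a b
... | inj₂ a | inj₂ b = G2 (punchIn v a) (punchIn v b)
... | inj₁ a | inj₂ b = if does (a ≟ u) then G2 v (punchIn v b) else false
... | inj₂ a | inj₁ b = if does (b ≟ u) then G2 (punchIn v a) v else false

-- Distances in the coalescence H split as d_H(x, y) = d₁(π₁ x, π₁ y) + d₂(π₂ x, π₂ y),
-- where π₁ collapses G₂ onto u and π₂ collapses G₁ onto v: a walk in H projects to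
-- one walk in each Gᵢ, and shortest walks in the Gᵢ concatenate through the cut
-- vertex. So if D_H x = 1, then (D₁ z₁)(π₁ i) + (D₂ z₂)(π₂ i) = 1 for every vertex i,
-- with zₖ the pushforward of x along πₖ. Letting i run over G₁ and over G₂ shows
-- that D₁ z₁ and D₂ z₂ are constant vectors K₁ and K₂ with K₁ + K₂ = 1; the nonzero
-- one rescales to a solution of D₁ y = 1 or of D₂ y = 1.

module Submission where

open import Defs
open import Data.Nat using (ℕ; suc; _+_; _≤_)
import Data.Nat.Properties as ℕ
open import Data.Fin using (Fin; _↑ˡ_; _↑ʳ_; punchIn; punchOut; _≟_; splitAt)
open import Data.Fin.Properties
  using (punchInᵢ≢i; punchOut-cong; punchOut-punchIn; punchIn-punchOut;
         splitAt-↑ˡ; splitAt-↑ʳ; splitAt⁻¹-↑ˡ; splitAt⁻¹-↑ʳ)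
open import Data.Bool using (true; false; if_then_else_)
open import Data.Empty using (⊥-elim)
open import Data.Sum using (_⊎_; inj₁; inj₂; [_,_])
open import Data.Product using (_×_; _,_; proj₁; proj₂; ∃₂)
open import Data.Integer as ℤ using (+_)
import Data.Integer.Properties as ℤ
open import Data.Rational using (ℚ; 0ℚ; 1ℚ; 1/_; ≢-nonZero; toℚᵘ)
  renaming (_+_ to _+ℚ_; _*_ to _*ℚ_)
open import Data.Rational.Properties
  using (+-*-commutativeRing; +-0-group; toℚᵘ-injective; toℚᵘ-fromℚᵘ; toℚᵘ-homo-+;
         *-assoc; *-identityʳ; +-identityʳ; *-zeroʳ; *-distribʳ-+; *-inverseʳ; +-identityˡ; 1≢0)
  renaming (_≟_ to _≟ℚ_)
import Data.Rational.Unnormalised as ℚᵘ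
import Data.Rational.Unnormalised.Properties as ℚᵘ
open import Algebra.Bundles using (CommutativeRing)
open import Algebra.Properties.Semiring.Sum (CommutativeRing.semiring +-*-commutativeRing)
open import Algebra.Properties.Group +-0-group using (∙-cancelˡ; ∙-cancelʳ)
open import Function using (id; const; _∘_)
open import Relation.Nullary using (¬_; does; yes; no)
open import Relation.Nullary.Decidable using (dec-true; dec-false)
open import Relation.Binary.PropositionalEquality using (_≡_; _≢_; refl; sym; trans; cong; cong₂; subst; subst₂; module ≡-Reasoning)

_++ʷ_ : ∀ {n} {G : Graph n} {i j l k k′} → Walk G i j k → Walk G j l k′ → Walk G i l (k + k′)
nil      ++ʷ w′ = w′
cons e w ++ʷ w′ = cons e (w ++ʷ w′)

map-Walk : ∀ {n p} {G : Graph n} {H : Graph p} (f : Fin n → Fin p) →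
           (∀ a b → G a b ≡ true → H (f a) (f b) ≡ true) →
           ∀ {i j k} → Walk G i j k → Walk H (f i) (f j) k
map-Walk f f-edge nil        = nil
map-Walk f f-edge (cons e w) = cons (f-edge _ _ e) (map-Walk f f-edge w)

distance-unique : ∀ {n} {G : Graph n} {i j d d′} → IsDistance G i j d → IsDistance G i j d′ → d ≡ d′
distance-unique (w , d-min) (w′ , d′-min) = ℕ.≤-antisym (d-min _ w′) (d′-min _ w)

distance-refl : ∀ {n} {G : Graph n} {D} → IsDistanceMatrix G D → ∀ i → D i i ≡ 0
distance-refl D-dist i = ℕ.n≤0⇒n≡0 (proj₂ (D-dist i i) 0 nil)

module Coalescence {m n′ : ℕ} (G₁ : Graph m) (G₂ : Graph (suc n′)) (u : Fin m) (v : Fin (suc n′)) where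

  H : Graph (m + n′)
  H = coalesce G₁ G₂ u v

  ι : Fin m → Fin (m + n′)
  ι a = a ↑ˡ n′

  ρ : Fin n′ → Fin (m + n′)
  ρ c = m ↑ʳ c

  data Side : Fin (m + n′) → Set where
    left  : ∀ a → Side (ι a)
    right : ∀ c → Side (ρ c)

  side : ∀ x → Side x
  side x with splitAt m x in eq
  ... | inj₁ a = subst Side (splitAt⁻¹-↑ˡ eq) (left a)
  ... | inj₂ c = subst Side (splitAt⁻¹-↑ʳ eq) (right c)

  π₁ : Fin (m + n′) → Fin m
  π₁ x = [ id , const u ] (splitAt m x)

  π₂ : Fin (m + n′) → Fin (suc n′)
  π₂ x = [ const v , punchIn v ] (splitAt m x)

  π₁-ι : ∀ a → π₁ (ι a) ≡ a
  π₁-ι a rewrite splitAt-↑ˡ m a n′ = refl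

  π₂-ι : ∀ a → π₂ (ι a) ≡ v
  π₂-ι a rewrite splitAt-↑ˡ m a n′ = refl

  π₁-ρ : ∀ c → π₁ (ρ c) ≡ u
  π₁-ρ c rewrite splitAt-↑ʳ m n′ c = refl

  π₂-ρ : ∀ c → π₂ (ρ c) ≡ punchIn v c
  π₂-ρ c rewrite splitAt-↑ʳ m n′ c = refl

  φ : Fin (suc n′) → Fin (m + n′)
  φ w with v ≟ w
  ... | yes _  = ι u
  ... | no v≢w = ρ (punchOut v≢w)

  φ-v : φ v ≡ ι u
  φ-v with v ≟ v
  ... | yes _  = refl
  ... | no v≢v = ⊥-elim (v≢v refl)

  φ-punchIn : ∀ c → φ (punchIn v c) ≡ ρ c
  φ-punchIn c with v ≟ punchIn v c
  ... | yes v≡vc = ⊥-elim (punchInᵢ≢i v c (sym v≡vc))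
  ... | no v≢vc  = cong ρ (trans (punchOut-cong v refl) (punchOut-punchIn v))

  π₁-φ : ∀ w → π₁ (φ w) ≡ u
  π₁-φ w with v ≟ w
  ... | yes _  = π₁-ι u
  ... | no v≢w = π₁-ρ (punchOut v≢w)

  π₂-φ : ∀ w → π₂ (φ w) ≡ w
  π₂-φ w with v ≟ w
  ... | yes refl = π₂-ι u
  ... | no v≢w   = trans (π₂-ρ (punchOut v≢w)) (punchIn-punchOut v≢w)

  ι-edge : ∀ a b → G₁ a b ≡ true → H (ι a) (ι b) ≡ true
  ι-edge a b e rewrite splitAt-↑ˡ m a n′ | splitAt-↑ˡ m b n′ = e

  H-ιρ : ∀ c → H (ι u) (ρ c) ≡ G₂ v (punchIn v c)
  H-ιρ c rewrite splitAt-↑ˡ m u n′ | splitAt-↑ʳ m n′ c | dec-true (u ≟ u) refl = refl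

  H-ρι : ∀ c → H (ρ c) (ι u) ≡ G₂ (punchIn v c) v
  H-ρι c rewrite splitAt-↑ʳ m n′ c | splitAt-↑ˡ m u n′ | dec-true (u ≟ u) refl = refl

  H-ρρ : ∀ c d → H (ρ c) (ρ d) ≡ G₂ (punchIn v c) (punchIn v d)
  H-ρρ c d rewrite splitAt-↑ʳ m n′ c | splitAt-↑ʳ m n′ d = refl

  φ-edge : (∀ w → G₂ w w ≡ false) → ∀ w w′ → G₂ w w′ ≡ true → H (φ w) (φ w′) ≡ true
  φ-edge irr w w′ e with v ≟ w | v ≟ w′
  ... | yes refl | yes refl with () ← trans (sym (irr v)) e
  ... | yes refl | no v≢w′  = trans (H-ιρ _) (trans (cong (G₂ v) (punchIn-punchOut v≢w′)) e)
  ... | no v≢w   | yes refl = trans (H-ρι _) (trans (cong (λ t → G₂ t v) (punchIn-punchOut v≢w)) e)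
  ... | no v≢w   | no v≢w′  = trans (H-ρρ _ _) (trans (cong₂ G₂ (punchIn-punchOut v≢w) (punchIn-punchOut v≢w′)) e)

  project-edge : ∀ x y → H x y ≡ true →
                 (G₁ (π₁ x) (π₁ y) ≡ true × π₂ x ≡ π₂ y) ⊎ (π₁ x ≡ π₁ y × G₂ (π₂ x) (π₂ y) ≡ true)
  project-edge x y e with splitAt m x | splitAt m y
  ... | inj₁ a | inj₁ b = inj₁ (e , refl)
  ... | inj₂ c | inj₂ d = inj₂ (refl , e)
  ... | inj₁ a | inj₂ d with a ≟ u
  ...   | yes refl = inj₂ (refl , e)
  ...   | no _     with () ← e
  project-edge x y e | inj₂ c | inj₁ b with b ≟ u
  ...   | yes refl = inj₂ (refl , e)
  ...   | no _     with () ← e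

  project : ∀ {x y k} → Walk H x y k →
            ∃₂ λ k₁ k₂ → Walk G₁ (π₁ x) (π₁ y) k₁ × Walk G₂ (π₂ x) (π₂ y) k₂ × k₁ + k₂ ≡ k
  project nil = 0 , 0 , nil , nil , refl
  project {x} (cons {l = l} e w) with project w | project-edge x l e
  ... | k₁ , k₂ , w₁ , w₂ , k≡ | inj₁ (e₁ , π₂≡) =
    suc k₁ , k₂ , cons e₁ w₁ , subst (λ t → Walk G₂ t (π₂ _) k₂) (sym π₂≡) w₂ , cong suc k≡
  ... | k₁ , k₂ , w₁ , w₂ , k≡ | inj₂ (π₁≡ , e₂) =
    k₁ , suc k₂ , subst (λ t → Walk G₁ t (π₁ _) k₁) (sym π₁≡) w₁ , cons e₂ w₂ , trans (ℕ.+-suc k₁ k₂) (cong suc k≡)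

  module _ {D₁ : Fin m → Fin m → ℕ} {D₂ : Fin (suc n′) → Fin (suc n′) → ℕ}
           (D₁-dist : IsDistanceMatrix G₁ D₁) (D₂-dist : IsDistanceMatrix G₂ D₂)
           (G₂-irrefl : ∀ w → G₂ w w ≡ false) where

    D : Fin (m + n′) → Fin (m + n′) → ℕ
    D x y = D₁ (π₁ x) (π₁ y) + D₂ (π₂ x) (π₂ y)

    D-minimal : ∀ {x y} k → Walk H x y k → D x y ≤ k
    D-minimal k w with project w
    ... | k₁ , k₂ , w₁ , w₂ , refl = ℕ.+-mono-≤ (proj₂ (D₁-dist _ _) k₁ w₁) (proj₂ (D₂-dist _ _) k₂ w₂)

    walk₁ : ∀ a b → Walk H (ι a) (ι b) (D₁ a b)
    walk₁ a b = map-Walk ι ι-edge (proj₁ (D₁-dist a b))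

    walk₂ : ∀ w w′ → Walk H (φ w) (φ w′) (D₂ w w′)
    walk₂ w w′ = map-Walk φ (φ-edge G₂-irrefl) (proj₁ (D₂-dist w w′))

    -- A walk between the two sides goes through the cut vertex ι u = φ v.
    D-walk : ∀ x y → Walk H x y (D x y)
    D-walk x y with side x | side y
    ... | left a  | left b
      rewrite π₁-ι a | π₁-ι b | π₂-ι a | π₂-ι b | distance-refl D₂-dist v | ℕ.+-identityʳ (D₁ a b)
      = walk₁ a b
    ... | left a  | right d
      rewrite π₁-ι a | π₁-ρ d | π₂-ι a | π₂-ρ d
      = walk₁ a u ++ʷ subst₂ (λ s t → Walk H s t _) φ-v (φ-punchIn d) (walk₂ v (punchIn v d))
    ... | right c | left b
      rewrite π₁-ρ c | π₁-ι b | π₂-ρ c | π₂-ι b | ℕ.+-comm (D₁ u b) (D₂ (punchIn v c) v)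
      = subst₂ (λ s t → Walk H s t _) (φ-punchIn c) φ-v (walk₂ (punchIn v c) v) ++ʷ walk₁ u b
    ... | right c | right d
      rewrite π₁-ρ c | π₁-ρ d | π₂-ρ c | π₂-ρ d | distance-refl D₁-dist u
      = subst₂ (λ s t → Walk H s t _) (φ-punchIn c) (φ-punchIn d) (walk₂ (punchIn v c) (punchIn v d))

    coalesce-distance : ∀ {DH} → IsDistanceMatrix H DH → ∀ x y → DH x y ≡ D x y
    coalesce-distance DH-dist x y = distance-unique (DH-dist x y) (D-walk x y , D-minimal)

ℕtoℚ-homo-+ : ∀ a b → ℕtoℚ (a + b) ≡ ℕtoℚ a +ℚ ℕtoℚ b
ℕtoℚ-homo-+ a b = toℚᵘ-injective (begin
  toℚᵘ (ℕtoℚ (a + b))                      ≈⟨ toℚᵘ-fromℚᵘ (ℚᵘ.mkℚᵘ (+ (a + b)) 0) ⟩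
  ℚᵘ.mkℚᵘ (+ (a + b)) 0                    ≈⟨ ℚᵘ.*≡* integral ⟩
  ℚᵘ.mkℚᵘ (+ a) 0 ℚᵘ.+ ℚᵘ.mkℚᵘ (+ b) 0     ≈⟨ ℚᵘ.+-cong (toℚᵘ-fromℚᵘ (ℚᵘ.mkℚᵘ (+ a) 0)) (toℚᵘ-fromℚᵘ (ℚᵘ.mkℚᵘ (+ b) 0)) ⟨
  toℚᵘ (ℕtoℚ a) ℚᵘ.+ toℚᵘ (ℕtoℚ b)         ≈⟨ toℚᵘ-homo-+ (ℕtoℚ a) (ℕtoℚ b) ⟨
  toℚᵘ (ℕtoℚ a +ℚ ℕtoℚ b)                  ∎)
  where
  open ℚᵘ.≃-Reasoning
  integral : + (a + b) ℤ.* + 1 ≡ (+ a ℤ.* + 1 ℤ.+ + b ℤ.* + 1) ℤ.* + 1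
  integral = cong (ℤ._* + 1) (sym (cong₂ ℤ._+_ (ℤ.*-identityʳ (+ a)) (ℤ.*-identityʳ (+ b))))

infixr 7 _*ᵥ_

_*ᵥ_ : ∀ {m n} → (Fin m → Fin n → ℕ) → (Fin n → ℚ) → Fin m → ℚ
(M *ᵥ x) i = ∑[ j < _ ] (ℕtoℚ (M i j) *ℚ x j)

δ : ∀ {n} → Fin n → Fin n → ℚ
δ c b = if does (c ≟ b) then 1ℚ else 0ℚ

push : ∀ {N n} → (Fin N → Fin n) → (Fin N → ℚ) → Fin n → ℚ
push f x b = ∑[ j < _ ] (δ (f j) b *ℚ x j)

∑-*-δ : ∀ {n} (g : Fin n → ℚ) (c : Fin n) → ∑[ b < n ] (g b *ℚ δ c b) ≡ g c
∑-*-δ {suc n} g c = begin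
  ∑[ b < suc n ] (g b *ℚ δ c b)
    ≡⟨ sum-remove {i = c} (λ b → g b *ℚ δ c b) ⟩
  g c *ℚ δ c c +ℚ ∑[ i < n ] (g (punchIn c i) *ℚ δ c (punchIn c i))
    ≡⟨ cong₂ _+ℚ_ (cong (g c *ℚ_) δ-diag) (sum-cong-≗ (λ i → cong (g (punchIn c i) *ℚ_) (δ-punchIn i))) ⟩
  g c *ℚ 1ℚ +ℚ ∑[ i < n ] (g (punchIn c i) *ℚ 0ℚ)
    ≡⟨ cong₂ _+ℚ_ (*-identityʳ (g c)) (trans (sum-cong-≗ (λ i → *-zeroʳ (g (punchIn c i)))) (sum-replicate-zero n)) ⟩
  g c +ℚ 0ℚ
    ≡⟨ +-identityʳ (g c) ⟩
  g c ∎
  where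
  open ≡-Reasoning
  δ-diag : δ c c ≡ 1ℚ
  δ-diag = cong (if_then 1ℚ else 0ℚ) (dec-true (c ≟ c) refl)
  δ-punchIn : ∀ i → δ c (punchIn c i) ≡ 0ℚ
  δ-punchIn i = cong (if_then 1ℚ else 0ℚ) (dec-false (c ≟ punchIn c i) (punchInᵢ≢i c i ∘ sym))

∑-*-push : ∀ {N n} (f : Fin N → Fin n) (g : Fin n → ℚ) (x : Fin N → ℚ) →
           ∑[ b < n ] (g b *ℚ push f x b) ≡ ∑[ j < N ] (g (f j) *ℚ x j)
∑-*-push {N} {n} f g x = begin
  ∑[ b < n ] (g b *ℚ ∑[ j < N ] (δ (f j) b *ℚ x j))
    ≡⟨ sum-cong-≗ (λ b → *-distribˡ-sum (g b) (λ j → δ (f j) b *ℚ x j)) ⟩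
  ∑[ b < n ] ∑[ j < N ] (g b *ℚ (δ (f j) b *ℚ x j))
    ≡⟨ ∑-comm (λ b j → g b *ℚ (δ (f j) b *ℚ x j)) ⟩
  ∑[ j < N ] ∑[ b < n ] (g b *ℚ (δ (f j) b *ℚ x j))
    ≡⟨ sum-cong-≗ (λ j → sum-cong-≗ (λ b → sym (*-assoc (g b) (δ (f j) b) (x j)))) ⟩
  ∑[ j < N ] ∑[ b < n ] (g b *ℚ δ (f j) b *ℚ x j)
    ≡⟨ sum-cong-≗ (λ j → sym (*-distribʳ-sum (x j) (λ b → g b *ℚ δ (f j) b))) ⟩
  ∑[ j < N ] (∑[ b < n ] (g b *ℚ δ (f j) b) *ℚ x j)
    ≡⟨ sum-cong-≗ (λ j → cong (_*ℚ x j) (∑-*-δ g (f j))) ⟩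
  ∑[ j < N ] (g (f j) *ℚ x j) ∎
  where open ≡-Reasoning

*ᵥ-push : ∀ {m N n} (M : Fin m → Fin n → ℕ) (f : Fin N → Fin n) (x : Fin N → ℚ) a →
          (M *ᵥ push f x) a ≡ ∑[ j < N ] (ℕtoℚ (M a (f j)) *ℚ x j)
*ᵥ-push M f x a = ∑-*-push f (λ b → ℕtoℚ (M a b)) x

*ᵥ-additive : ∀ {N m n} (M : Fin N → Fin N → ℕ) (M₁ : Fin m → Fin m → ℕ) (M₂ : Fin n → Fin n → ℕ)
              (p₁ : Fin N → Fin m) (p₂ : Fin N → Fin n) →
              (∀ i j → M i j ≡ M₁ (p₁ i) (p₁ j) + M₂ (p₂ i) (p₂ j)) →
              ∀ x i → (M *ᵥ x) i ≡ (M₁ *ᵥ push p₁ x) (p₁ i) +ℚ (M₂ *ᵥ push p₂ x) (p₂ i)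
*ᵥ-additive {N} M M₁ M₂ p₁ p₂ M≡ x i = begin
  ∑[ j < N ] (ℕtoℚ (M i j) *ℚ x j)
    ≡⟨ sum-cong-≗ split-term ⟩
  ∑[ j < N ] (ℕtoℚ (M₁ (p₁ i) (p₁ j)) *ℚ x j +ℚ ℕtoℚ (M₂ (p₂ i) (p₂ j)) *ℚ x j)
    ≡⟨ ∑-distrib-+ (λ j → ℕtoℚ (M₁ (p₁ i) (p₁ j)) *ℚ x j) (λ j → ℕtoℚ (M₂ (p₂ i) (p₂ j)) *ℚ x j) ⟩
  ∑[ j < N ] (ℕtoℚ (M₁ (p₁ i) (p₁ j)) *ℚ x j) +ℚ ∑[ j < N ] (ℕtoℚ (M₂ (p₂ i) (p₂ j)) *ℚ x j)
    ≡⟨ cong₂ _+ℚ_ (*ᵥ-push M₁ p₁ x (p₁ i)) (*ᵥ-push M₂ p₂ x (p₂ i)) ⟨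
  (M₁ *ᵥ push p₁ x) (p₁ i) +ℚ (M₂ *ᵥ push p₂ x) (p₂ i) ∎
  where
  open ≡-Reasoning
  split-term : ∀ j → ℕtoℚ (M i j) *ℚ x j ≡ ℕtoℚ (M₁ (p₁ i) (p₁ j)) *ℚ x j +ℚ ℕtoℚ (M₂ (p₂ i) (p₂ j)) *ℚ x j
  split-term j = begin
    ℕtoℚ (M i j) *ℚ x j
      ≡⟨ cong (λ k → ℕtoℚ k *ℚ x j) (M≡ i j) ⟩
    ℕtoℚ (M₁ (p₁ i) (p₁ j) + M₂ (p₂ i) (p₂ j)) *ℚ x j
      ≡⟨ cong (_*ℚ x j) (ℕtoℚ-homo-+ (M₁ (p₁ i) (p₁ j)) (M₂ (p₂ i) (p₂ j))) ⟩
    (ℕtoℚ (M₁ (p₁ i) (p₁ j)) +ℚ ℕtoℚ (M₂ (p₂ i) (p₂ j))) *ℚ x j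
      ≡⟨ *-distribʳ-+ (x j) (ℕtoℚ (M₁ (p₁ i) (p₁ j))) (ℕtoℚ (M₂ (p₂ i) (p₂ j))) ⟩
    ℕtoℚ (M₁ (p₁ i) (p₁ j)) *ℚ x j +ℚ ℕtoℚ (M₂ (p₂ i) (p₂ j)) *ℚ x j ∎

hasSolutionOnes-scale : ∀ {n} (M : Fin n → Fin n → ℕ) (z : Fin n → ℚ) (K : ℚ) →
                        K ≢ 0ℚ → (∀ i → (M *ᵥ z) i ≡ K) → HasSolutionOnes M
hasSolutionOnes-scale {n} M z K K≢0 Mz≡K = (λ j → z j *ℚ 1/ K) , λ i → begin
  ∑[ j < n ] (ℕtoℚ (M i j) *ℚ (z j *ℚ 1/ K))
    ≡⟨ sum-cong-≗ (λ j → sym (*-assoc (ℕtoℚ (M i j)) (z j) (1/ K))) ⟩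
  ∑[ j < n ] (ℕtoℚ (M i j) *ℚ z j *ℚ 1/ K)
    ≡⟨ *-distribʳ-sum (1/ K) (λ j → ℕtoℚ (M i j) *ℚ z j) ⟨
  (M *ᵥ z) i *ℚ 1/ K
    ≡⟨ cong (_*ℚ 1/ K) (Mz≡K i) ⟩
  K *ℚ 1/ K
    ≡⟨ *-inverseʳ K ⟩
  1ℚ ∎
  where
  open ≡-Reasoning
  instance
    _ = ≢-nonZero K≢0

cross-constant : ∀ {m n} (R₁ : Fin m → ℚ) (R₂ : Fin n → ℚ) (u : Fin m) (v : Fin n) {c : ℚ} →
                 (∀ a → R₁ a +ℚ R₂ v ≡ c) → (∀ w → R₁ u +ℚ R₂ w ≡ c) →
                 (∀ a → R₁ a ≡ R₁ u) × (∀ w → R₂ w ≡ R₂ v)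
cross-constant R₁ R₂ u v row col =
  (λ a → ∙-cancelʳ (R₂ v) (R₁ a) (R₁ u) (trans (row a) (sym (row u)))) ,
  (λ w → ∙-cancelˡ (R₁ u) (R₂ w) (R₂ v) (trans (col w) (sym (row u))))

sum≡1⇒nonzero : ∀ p q → p +ℚ q ≡ 1ℚ → p ≢ 0ℚ ⊎ q ≢ 0ℚ
sum≡1⇒nonzero p q p+q≡1 with p ≟ℚ 0ℚ
... | no p≢0 = inj₁ p≢0
... | yes refl = inj₂ λ q≡0 → 1≢0 (trans (sym p+q≡1) (trans (+-identityˡ q) q≡0))

theorem6 : ∀ {m n'} (G1 : Graph m) (G2 : Graph (suc n'))
             (u : Fin m) (v : Fin (suc n'))
             (D1 : Fin m → Fin m → ℕ) (D2 : Fin (suc n') → Fin (suc n') → ℕ)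
             (DH : Fin (m + n') → Fin (m + n') → ℕ) →
             IsSimple G1 → IsSimple G2 → Connected G1 → Connected G2 →
             IsDistanceMatrix G1 D1 → IsDistanceMatrix G2 D2 →
             ¬ HasSolutionOnes D1 → ¬ HasSolutionOnes D2 →
             IsDistanceMatrix (coalesce G1 G2 u v) DH →
             ¬ HasSolutionOnes DH
-- Connectedness is implied by the distance matrices, and of simplicity only loop-freeness of G2 is used.
theorem6 G1 G2 u v D1 D2 DH _ (_ , G2-irrefl) _ _ D1-dist D2-dist ¬sol₁ ¬sol₂ DH-dist (x , DHx≡1) =
  [ (λ K₁≢0 → ¬sol₁ (hasSolutionOnes-scale D1 (push π₁ x) K₁ K₁≢0 (proj₁ constant)))
  , (λ K₂≢0 → ¬sol₂ (hasSolutionOnes-scale D2 (push π₂ x) K₂ K₂≢0 (proj₂ constant)))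
  ] (sum≡1⇒nonzero K₁ K₂ (row u))
  where
  open Coalescence G1 G2 u v
  R₁ : Fin _ → ℚ
  R₁ = D1 *ᵥ push π₁ x
  R₂ : Fin _ → ℚ
  R₂ = D2 *ᵥ push π₂ x
  K₁ K₂ : ℚ
  K₁ = R₁ u
  K₂ = R₂ v

  rows : ∀ i → R₁ (π₁ i) +ℚ R₂ (π₂ i) ≡ 1ℚ
  rows i = trans (sym (*ᵥ-additive DH D1 D2 π₁ π₂ (coalesce-distance D1-dist D2-dist G2-irrefl DH-dist) x i))
                 (DHx≡1 i)

  row : ∀ a → R₁ a +ℚ R₂ v ≡ 1ℚ
  row a = subst₂ (λ s t → R₁ s +ℚ R₂ t ≡ 1ℚ) (π₁-ι a) (π₂-ι a) (rows (ι a))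

  column : ∀ w → R₁ u +ℚ R₂ w ≡ 1ℚ
  column w = subst₂ (λ s t → R₁ s +ℚ R₂ t ≡ 1ℚ) (π₁-φ w) (π₂-φ w) (rows (φ w))

  constant : (∀ a → R₁ a ≡ K₁) × (∀ w → R₂ w ≡ K₂)
  constant = cross-constant R₁ R₂ u v row column
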